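{- For $x=(a,b,c,d)\in\mathbb{Z}^4$, $P(x)\equiv4\pmod{16}$ if and only if one of the following holds: (1) $a,b,c,d$ are all odd and $a+b+c+d\equiv2\pmod 4$; (2) $b,c$ are even and $ad\equiv2\pmod4$; (3) $a\equiv0\pmod4$, $b\equiv2\pmod4$, and $c$ is odd; (4) $d\equiv0\pmod4$, $c\equiv2\pmod4$, and $b$ is odd; (5) $b+c$ is odd and $a+c\equiv b+d\equiv0\pmod4$.
   Context: $P(x)=b^2c^2+18abcd-4ac^3-4b^3d-27a^2d^2$ is the discriminant of the binary cubic form $au^3+bu^2v+cuv^2+dv^3$, identified with $x=(a,b,c,d)$. -}

module Defs where

open import Data.Integer using (ℤ; +_; _+_; _-_; _*_; _^_)
open import Data.Integer.Divisibility using (_∣_)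

infix 4 _≡_[mod_]
_≡_[mod_] : ℤ → ℤ → ℤ → Set
x ≡ y [mod m ] = m ∣ (x - y)

Odd : ℤ → Set
Odd x = x ≡ + 1 [mod + 2 ]

Even : ℤ → Set
Even x = x ≡ + 0 [mod + 2 ]

-- discriminant of the binary cubic form a u^3 + b u^2 v + c u v^2 + d v^3
disc : ℤ → ℤ → ℤ → ℤ → ℤ
disc a b c d =
  b ^ 2 * c ^ 2 + + 18 * a * b * c * d - + 4 * a * c ^ 3
    - + 4 * b ^ 3 * d - + 27 * a ^ 2 * d ^ 2

module Submission where

-- Moving one coefficient of the form by 8 changes disc by a multiple of 16: every partial
-- derivative of disc is even, and the second-order terms already carry a factor 64.
-- The five conditions only look at residues mod 4 and mod 2 of sums and products of the
-- coefficients. Hence both sides of the equivalence depend only on (a, b, c, d) mod 8,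
-- and it suffices to compare them on the 8⁴ residue classes, which is done by evaluation.

open import Defs
open import Data.Integer using (ℤ; +_; _+_; _*_)
open import Data.Product using (_×_)
open import Data.Sum using (_⊎_)
open import Function.Bundles using (_⇔_)

open import Data.Integer using (_-_; -_; _^_; ∣_∣)
open import Data.Integer.DivMod using (_/ℕ_; a≡a%ℕn+[a/ℕn]*n; n%ℕd<d)
import Data.Integer.Divisibility.Signed as Signed
open import Data.Integer.Solver using (module +-*-Solver)
open +-*-Solver using (Polynomial; con; _:+_; _:*_; _:-_; _:^_; _:=_; solve)
open import Data.Integer.Tactic.RingSolver using (solve-∀)
open import Data.Fin using (Fin; toℕ; fromℕ<)
open import Data.Fin.Properties using (toℕ-fromℕ<; all?)
import Data.Nat.Divisibility as ℕ
open import Data.Product using (_,_)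
open import Data.Product.Function.NonDependent.Propositional using (_×-⇔_)
open import Data.Sum.Function.Propositional using (_⊎-⇔_)
open import Function.Bundles using (mk⇔; Equivalence)
open import Function.Properties.Equivalence using (⇔-setoid)
open import Level using (0ℓ)
open import Relation.Binary.Bundles using (Setoid)
open import Relation.Binary.Structures using (IsEquivalence)
import Relation.Binary.Reasoning.Setoid as ≈-Reasoning
open import Relation.Binary.PropositionalEquality using (_≡_; refl; trans; cong; subst)
open import Relation.Nullary using (Dec; _×-dec_; _⊎-dec_; _→-dec_; map′; from-yes)

private
  variable
    m x y u v r a b c d a′ b′ c′ d′ : ℤ

-- Unlike _≡_[mod_], which unfolds to divisibility of absolute values, this keeps x, y
-- and m visible to unification and names the quotient.
record Congruent (m x y : ℤ) : Set where
  constructor congruent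
  field
    quotient : ℤ
    equation : x ≡ y + quotient * m

Congruent-refl : Congruent m x x
Congruent-refl {m} {x} = congruent (+ 0) (identity x m)
  where
  identity : ∀ x m → x ≡ x + + 0 * m
  identity = solve-∀

Congruent-sym : Congruent m x y → Congruent m y x
Congruent-sym {m} {y = y} (congruent k refl) = congruent (- k) (identity y k m)
  where
  identity : ∀ y k m → y ≡ y + k * m + - k * m
  identity = solve-∀

Congruent-trans : Congruent m x y → Congruent m y u → Congruent m x u
Congruent-trans {m} {u = u} (congruent k refl) (congruent l refl) =
  congruent (l + k) (identity u l k m)
  where
  identity : ∀ u l k m → u + l * m + k * m ≡ u + (l + k) * m
  identity = solve-∀

Congruent-isEquivalence : ∀ m → IsEquivalence (Congruent m)
Congruent-isEquivalence m = record
  { refl  = Congruent-refl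
  ; sym   = Congruent-sym
  ; trans = Congruent-trans
  }

Congruent-setoid : ℤ → Setoid 0ℓ 0ℓ
Congruent-setoid m = record { isEquivalence = Congruent-isEquivalence m }

+-cong-Congruent : Congruent m x y → Congruent m u v → Congruent m (x + u) (y + v)
+-cong-Congruent {m} {y = y} {v = v} (congruent k refl) (congruent l refl) =
  congruent (k + l) (identity y v k l m)
  where
  identity : ∀ y v k l m → y + k * m + (v + l * m) ≡ y + v + (k + l) * m
  identity = solve-∀

*-cong-Congruent : Congruent m x y → Congruent m u v → Congruent m (x * u) (y * v)
*-cong-Congruent {m} {y = y} {v = v} (congruent k refl) (congruent l refl) =
  congruent (k * v + y * l + k * l * m) (identity y v k l m)
  where
  identity : ∀ y v k l m → (y + k * m) * (v + l * m) ≡ y * v + (k * v + y * l + k * l * m) * m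
  identity = solve-∀

Congruent-weaken : ∀ n → Congruent (n * m) x y → Congruent m x y
Congruent-weaken {m} {y = y} n (congruent k refl) = congruent (k * n) (identity y k n m)
  where
  identity : ∀ y k n m → y + k * (n * m) ≡ y + k * n * m
  identity = solve-∀

Congruent⇒≡[mod] : Congruent m x y → x ≡ y [mod m ]
Congruent⇒≡[mod] {m} {x} {y} (congruent k x≡y+km) =
  Signed.∣⇒∣ᵤ {m} {x - y}
    (Signed.divides k (trans (cong (_- y) x≡y+km) (identity y (k * m))))
  where
  identity : ∀ y t → y + t - y ≡ t
  identity = solve-∀

Congruent-resp-≡[mod] : Congruent m x y → (x ≡ r [mod m ]) ⇔ (y ≡ r [mod m ])
Congruent-resp-≡[mod] {m} {r = r} x≡y = mk⇔ (transfer x≡y) (transfer (Congruent-sym x≡y))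
  where
  transfer : Congruent m u v → u ≡ r [mod m ] → v ≡ r [mod m ]
  transfer {u} {v} u≡v u≡r = Signed.∣⇒∣ᵤ {m} {v - r}
    (subst (m Signed.∣_) (identity u v r)
      (Signed.∣m∣n⇒∣m-n (Signed.∣ᵤ⇒∣ {m} {u - r} u≡r)
                        (Signed.∣ᵤ⇒∣ {m} {u - v} (Congruent⇒≡[mod] u≡v))))
    where
    identity : ∀ u v r → u - r - (u - v) ≡ v - r
    identity = solve-∀

-- Its denotation unfolds definitionally to disc, so solver equations between
-- Disc-expressions typecheck as equations about disc itself.
Disc : ∀ {k} → Polynomial k → Polynomial k → Polynomial k → Polynomial k → Polynomial k
Disc a b c d =
  b :^ 2 :* c :^ 2 :+ con (+ 18) :* a :* b :* c :* d :- con (+ 4) :* a :* c :^ 3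
    :- con (+ 4) :* b :^ 3 :* d :- con (+ 27) :* a :^ 2 :* d :^ 2

disc-shift₁ : ∀ a b c d p → Congruent (+ 16) (disc (a + p * + 8) b c d) (disc a b c d)
disc-shift₁ a b c d p = congruent
  (p * (+ 9 * b * c * d - + 2 * c ^ 3) - + 27 * d ^ 2 * (a * p + + 4 * p ^ 2))
  (solve 5 (λ a b c d p →
    Disc (a :+ p :* con (+ 8)) b c d
      := Disc a b c d :+ (p :* (con (+ 9) :* b :* c :* d :- con (+ 2) :* c :^ 3)
           :- con (+ 27) :* d :^ 2 :* (a :* p :+ con (+ 4) :* p :^ 2)) :* con (+ 16))
    refl a b c d p)

disc-shift₂ : ∀ a b c d q → Congruent (+ 16) (disc a (b + q * + 8) c d) (disc a b c d)
disc-shift₂ a b c d q = congruent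
  (c ^ 2 * (b * q + + 4 * q ^ 2) + + 9 * a * c * d * q
     - d * (+ 6 * b ^ 2 * q + + 48 * b * q ^ 2 + + 128 * q ^ 3))
  (solve 5 (λ a b c d q →
    Disc a (b :+ q :* con (+ 8)) c d
      := Disc a b c d
         :+ (c :^ 2 :* (b :* q :+ con (+ 4) :* q :^ 2) :+ con (+ 9) :* a :* c :* d :* q
             :- d :* (con (+ 6) :* b :^ 2 :* q :+ con (+ 48) :* b :* q :^ 2
                      :+ con (+ 128) :* q :^ 3)) :* con (+ 16))
    refl a b c d q)

disc-shift₃ : ∀ a b c d r → Congruent (+ 16) (disc a b (c + r * + 8) d) (disc a b c d)
disc-shift₃ a b c d r = congruent
  (b ^ 2 * (c * r + + 4 * r ^ 2) + + 9 * a * b * d * r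
     - a * (+ 6 * c ^ 2 * r + + 48 * c * r ^ 2 + + 128 * r ^ 3))
  (solve 5 (λ a b c d r →
    Disc a b (c :+ r :* con (+ 8)) d
      := Disc a b c d
         :+ (b :^ 2 :* (c :* r :+ con (+ 4) :* r :^ 2) :+ con (+ 9) :* a :* b :* d :* r
             :- a :* (con (+ 6) :* c :^ 2 :* r :+ con (+ 48) :* c :* r :^ 2
                      :+ con (+ 128) :* r :^ 3)) :* con (+ 16))
    refl a b c d r)

disc-shift₄ : ∀ a b c d s → Congruent (+ 16) (disc a b c (d + s * + 8)) (disc a b c d)
disc-shift₄ a b c d s = congruent
  (s * (+ 9 * a * b * c - + 2 * b ^ 3) - + 27 * a ^ 2 * (d * s + + 4 * s ^ 2))
  (solve 5 (λ a b c d s →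
    Disc a b c (d :+ s :* con (+ 8))
      := Disc a b c d :+ (s :* (con (+ 9) :* a :* b :* c :- con (+ 2) :* b :^ 3)
           :- con (+ 27) :* a :^ 2 :* (d :* s :+ con (+ 4) :* s :^ 2)) :* con (+ 16))
    refl a b c d s)

disc-cong : Congruent (+ 8) a a′ → Congruent (+ 8) b b′ →
            Congruent (+ 8) c c′ → Congruent (+ 8) d d′ →
            Congruent (+ 16) (disc a b c d) (disc a′ b′ c′ d′)
disc-cong {a′ = a′} {b′ = b′} {c′ = c′} {d′ = d′}
          (congruent p refl) (congruent q refl) (congruent r refl) (congruent s refl) = begin
  disc (a′ + p * + 8) (b′ + q * + 8) (c′ + r * + 8) (d′ + s * + 8)
    ≈⟨ disc-shift₁ a′ (b′ + q * + 8) (c′ + r * + 8) (d′ + s * + 8) p ⟩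
  disc a′ (b′ + q * + 8) (c′ + r * + 8) (d′ + s * + 8)
    ≈⟨ disc-shift₂ a′ b′ (c′ + r * + 8) (d′ + s * + 8) q ⟩
  disc a′ b′ (c′ + r * + 8) (d′ + s * + 8)
    ≈⟨ disc-shift₃ a′ b′ c′ (d′ + s * + 8) r ⟩
  disc a′ b′ c′ (d′ + s * + 8)
    ≈⟨ disc-shift₄ a′ b′ c′ d′ s ⟩
  disc a′ b′ c′ d′
    ∎
  where open ≈-Reasoning (Congruent-setoid (+ 16))

DiscCondition : ℤ → ℤ → ℤ → ℤ → Set
DiscCondition a b c d = disc a b c d ≡ + 4 [mod + 16 ]

ResidueConditions : ℤ → ℤ → ℤ → ℤ → Set
ResidueConditions a b c d =
  ((Odd a × Odd b × Odd c × Odd d × (a + b + c + d ≡ + 2 [mod + 4 ]))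
  ⊎ (Even b × Even c × (a * d ≡ + 2 [mod + 4 ]))
  ⊎ ((a ≡ + 0 [mod + 4 ]) × (b ≡ + 2 [mod + 4 ]) × Odd c)
  ⊎ ((d ≡ + 0 [mod + 4 ]) × (c ≡ + 2 [mod + 4 ]) × Odd b)
  ⊎ (Odd (b + c) × (a + c ≡ + 0 [mod + 4 ]) × (b + d ≡ + 0 [mod + 4 ])))

DiscCondition-cong : Congruent (+ 8) a a′ → Congruent (+ 8) b b′ →
                     Congruent (+ 8) c c′ → Congruent (+ 8) d d′ →
                     DiscCondition a b c d ⇔ DiscCondition a′ b′ c′ d′
DiscCondition-cong a≡a′ b≡b′ c≡c′ d≡d′ = Congruent-resp-≡[mod] (disc-cong a≡a′ b≡b′ c≡c′ d≡d′)

ResidueConditions-cong : Congruent (+ 8) a a′ → Congruent (+ 8) b b′ →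
                         Congruent (+ 8) c c′ → Congruent (+ 8) d d′ →
                         ResidueConditions a b c d ⇔ ResidueConditions a′ b′ c′ d′
ResidueConditions-cong a≡a′ b≡b′ c≡c′ d≡d′ =
  (mod2 (+ 1) a≡a′ ×-⇔ mod2 (+ 1) b≡b′ ×-⇔ mod2 (+ 1) c≡c′ ×-⇔ mod2 (+ 1) d≡d′
     ×-⇔ mod4 (+ 2) (a≡a′ +ᶜ b≡b′ +ᶜ c≡c′ +ᶜ d≡d′))
  ⊎-⇔ (mod2 (+ 0) b≡b′ ×-⇔ mod2 (+ 0) c≡c′ ×-⇔ mod4 (+ 2) (*-cong-Congruent a≡a′ d≡d′))
  ⊎-⇔ (mod4 (+ 0) a≡a′ ×-⇔ mod4 (+ 2) b≡b′ ×-⇔ mod2 (+ 1) c≡c′)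
  ⊎-⇔ (mod4 (+ 0) d≡d′ ×-⇔ mod4 (+ 2) c≡c′ ×-⇔ mod2 (+ 1) b≡b′)
  ⊎-⇔ (mod2 (+ 1) (b≡b′ +ᶜ c≡c′) ×-⇔ mod4 (+ 0) (a≡a′ +ᶜ c≡c′)
         ×-⇔ mod4 (+ 0) (b≡b′ +ᶜ d≡d′))
  where
  infixl 6 _+ᶜ_
  _+ᶜ_ : Congruent (+ 8) x y → Congruent (+ 8) u v → Congruent (+ 8) (x + u) (y + v)
  _+ᶜ_ = +-cong-Congruent
  mod2 : ∀ r → Congruent (+ 8) x y → (x ≡ r [mod + 2 ]) ⇔ (y ≡ r [mod + 2 ])
  mod2 r x≡y = Congruent-resp-≡[mod] (Congruent-weaken {+ 2} (+ 4) x≡y)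
  mod4 : ∀ r → Congruent (+ 8) x y → (x ≡ r [mod + 4 ]) ⇔ (y ≡ r [mod + 4 ])
  mod4 r x≡y = Congruent-resp-≡[mod] (Congruent-weaken {+ 4} (+ 2) x≡y)

infix 4 _≡?_[mod_]
_≡?_[mod_] : ∀ x y m → Dec (x ≡ y [mod m ])
x ≡? y [mod m ] = ∣ m ∣ ℕ.∣? ∣ x - y ∣

_⇔?_ : {A B : Set} → Dec A → Dec B → Dec (A ⇔ B)
A? ⇔? B? = map′ (λ (to , from) → mk⇔ to from)
                (λ A⇔B → Equivalence.to A⇔B , Equivalence.from A⇔B)
                ((A? →-dec B?) ×-dec (B? →-dec A?))

DiscCondition? : ∀ a b c d → Dec (DiscCondition a b c d)
DiscCondition? a b c d = disc a b c d ≡? + 4 [mod + 16 ]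

ResidueConditions? : ∀ a b c d → Dec (ResidueConditions a b c d)
ResidueConditions? a b c d =
  (odd? a ×-dec odd? b ×-dec odd? c ×-dec odd? d ×-dec a + b + c + d ≡? + 2 [mod + 4 ])
  ⊎-dec (even? b ×-dec even? c ×-dec a * d ≡? + 2 [mod + 4 ])
  ⊎-dec (a ≡? + 0 [mod + 4 ] ×-dec b ≡? + 2 [mod + 4 ] ×-dec odd? c)
  ⊎-dec (d ≡? + 0 [mod + 4 ] ×-dec c ≡? + 2 [mod + 4 ] ×-dec odd? b)
  ⊎-dec (odd? (b + c) ×-dec a + c ≡? + 0 [mod + 4 ] ×-dec b + d ≡? + 0 [mod + 4 ])
  where
  odd? : ∀ x → Dec (Odd x)
  odd? x = x ≡? + 1 [mod + 2 ]
  even? : ∀ x → Dec (Even x)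
  even? x = x ≡? + 0 [mod + 2 ]

[_]₈ : Fin 8 → ℤ
[ i ]₈ = + toℕ i

residue-table : ∀ i j k l →
  DiscCondition [ i ]₈ [ j ]₈ [ k ]₈ [ l ]₈ ⇔ ResidueConditions [ i ]₈ [ j ]₈ [ k ]₈ [ l ]₈
residue-table = from-yes
  (all? λ (i : Fin 8) → all? λ (j : Fin 8) → all? λ (k : Fin 8) → all? λ (l : Fin 8) →
    DiscCondition? [ i ]₈ [ j ]₈ [ k ]₈ [ l ]₈ ⇔? ResidueConditions? [ i ]₈ [ j ]₈ [ k ]₈ [ l ]₈)

residue : ℤ → Fin 8
residue x = fromℕ< (n%ℕd<d x 8)

residue-cong : ∀ x → Congruent (+ 8) x [ residue x ]₈
residue-cong x rewrite toℕ-fromℕ< (n%ℕd<d x 8) = congruent (x /ℕ 8) (a≡a%ℕn+[a/ℕn]*n x 8)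

lemma2p5 : (a b c d : ℤ) →
    (disc a b c d ≡ + 4 [mod + 16 ]) ⇔
    ((Odd a × Odd b × Odd c × Odd d × (a + b + c + d ≡ + 2 [mod + 4 ]))
    ⊎ (Even b × Even c × (a * d ≡ + 2 [mod + 4 ]))
    ⊎ ((a ≡ + 0 [mod + 4 ]) × (b ≡ + 2 [mod + 4 ]) × Odd c)
    ⊎ ((d ≡ + 0 [mod + 4 ]) × (c ≡ + 2 [mod + 4 ]) × Odd b)
    ⊎ (Odd (b + c) × (a + c ≡ + 0 [mod + 4 ]) × (b + d ≡ + 0 [mod + 4 ])))
lemma2p5 a b c d = begin
  DiscCondition a b c d
    ≈⟨ DiscCondition-cong (residue-cong a) (residue-cong b) (residue-cong c) (residue-cong d) ⟩
  DiscCondition [ residue a ]₈ [ residue b ]₈ [ residue c ]₈ [ residue d ]₈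
    ≈⟨ residue-table (residue a) (residue b) (residue c) (residue d) ⟩
  ResidueConditions [ residue a ]₈ [ residue b ]₈ [ residue c ]₈ [ residue d ]₈
    ≈⟨ ResidueConditions-cong (residue-cong a) (residue-cong b) (residue-cong c) (residue-cong d) ⟨
  ResidueConditions a b c d
    ∎
  where open ≈-Reasoning (⇔-setoid 0ℓ)
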